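{- Let $G=(V,E)$ be a fork-free graph and $I$ an independent set of $G$. Let $c\in V$ be a vertex adjacent to exactly $k\ge 3$ vertices of $I$, and let $I'$ be an independent set such that there is a TS-reconfiguration sequence from $I$ to $I'$. Then $c$ is adjacent to exactly $k$ vertices of $I'$.
   Context: A fork is the claw $K_{1,3}$ with one edge subdivided once; fork-free means no induced subgraph isomorphic to the fork. Two independent sets $A,B$ are TS-adjacent if $A\setminus B=\{x\}$, $B\setminus A=\{y\}$ and $xy\in E$; a TS-reconfiguration sequence is a sequence of independent sets with consecutive ones TS-adjacent. -}

module Defs where

open import Data.Nat using (ℕ)
open import Data.Bool using (Bool; true; false; if_then_else_)
open import Data.Fin using (Fin; zero; suc)
open import Data.Fin.Subset using (Subset; Side; inside; outside; _∈_; _∉_; _∩_; ∣_∣)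
open import Data.Vec using (tabulate)
open import Data.Product using (Σ; ∃; ∃-syntax; _×_; _,_)
open import Relation.Binary.PropositionalEquality using (_≡_)
open import Relation.Nullary using (¬_)
open import Function.Bundles using (_⇔_)
open import Relation.Binary.Construct.Closure.ReflexiveTransitive using (Star)

record Graph (n : ℕ) : Set where
  field
    adj    : Fin n → Fin n → Bool
    sym    : ∀ u v → adj u v ≡ adj v u
    irrefl : ∀ v → adj v v ≡ false
open Graph public

Edge : ∀ {n} → Graph n → Fin n → Fin n → Set
Edge G u v = adj G u v ≡ true

-- The fork: vertices 0..4, edges 0-1, 0-2, 0-3 (a claw with centre 0) and 3-4
-- (the edge 0-3 subdivided once, by vertex 3, i.e. claw edge 0-4 subdivided).
forkAdj : Fin 5 → Fin 5 → Bool
forkAdj zero (suc zero) = true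
forkAdj zero (suc (suc zero)) = true
forkAdj zero (suc (suc (suc zero))) = true
forkAdj (suc zero) zero = true
forkAdj (suc (suc zero)) zero = true
forkAdj (suc (suc (suc zero))) zero = true
forkAdj (suc (suc (suc zero))) (suc (suc (suc (suc zero)))) = true
forkAdj (suc (suc (suc (suc zero)))) (suc (suc (suc zero))) = true
forkAdj _ _ = false

InducedFork : ∀ {n} → Graph n → Set
InducedFork {n} G =
  Σ (Fin 5 → Fin n) λ f →
    (∀ i j → f i ≡ f j → i ≡ j) × (∀ i j → adj G (f i) (f j) ≡ forkAdj i j)

ForkFree : ∀ {n} → Graph n → Set
ForkFree G = ¬ InducedFork G

Independent : ∀ {n} → Graph n → Subset n → Set
Independent G I = ∀ u v → u ∈ I → v ∈ I → ¬ Edge G u v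

nbhd : ∀ {n} → Graph n → Fin n → Subset n
nbhd G c = tabulate λ v → if adj G c v then inside else outside

degIn : ∀ {n} → Graph n → Fin n → Subset n → ℕ
degIn G c I = ∣ nbhd G c ∩ I ∣

TSAdj : ∀ {n} → Graph n → Subset n → Subset n → Set
TSAdj {n} G A B =
  ∃[ x ] ∃[ y ]
    ((∀ z → (z ∈ A × z ∉ B) ⇔ (z ≡ x)) ×
     (∀ z → (z ∈ B × z ∉ A) ⇔ (z ≡ y)) ×
     Edge G x y)

TSStep : ∀ {n} → Graph n → Subset n → Subset n → Set
TSStep G A B = Independent G A × Independent G B × TSAdj G A B

TSReach : ∀ {n} → Graph n → Subset n → Subset n → Set
TSReach G = Star (TSStep G)

-- If c has at least three neighbours in A, then at least two of them, a₁ and a₂,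
-- differ from the vertex x whose token slides to y, so they stay in B.  Were c
-- adjacent to exactly one of x and y, then c, a₁, a₂ and the edge xy would
-- induce a fork; so c sees both or neither, and its number of neighbours in the
-- independent set is unchanged, which keeps the bound k ≥ 3 along the sequence.
module Submission where

open import Defs hiding (sym)
open import Data.Nat using (ℕ; suc; _≤_; _<_; s≤s; s≤s⁻¹)
open import Data.Nat.Properties using (≤-trans; ≤-reflexive; n≤1+n)
open import Data.Bool using (true; false; if_then_else_)
open import Data.Bool.Properties using (¬-not) renaming (_≟_ to _≟ᵇ_)
open import Data.Fin using (Fin; zero; suc)
open import Data.Fin.Subset
  using (Subset; inside; outside; _∈_; _∉_; _⊆_; _∩_; _-_; ∣_∣; Nonempty)
open import Data.Fin.Subset.Properties
  using (_∈?_; x∈p∩q⁺; x∈p∩q⁻; p─q⊆p; p─⊥≡p; x∈p∧x≢y⇒x∈p-y; ⊆-antisym)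
open import Data.Vec using (_∷_; here; there; lookup; tabulate)
open import Data.Vec.Properties using (lookup∘tabulate; lookup⇒[]=; []=⇒lookup)
open import Data.Product using (∃; _×_; _,_; proj₁; proj₂)
open import Data.Empty using (⊥-elim)
open import Relation.Nullary using (¬_; yes; no)
open import Relation.Nullary.Decidable using (decidable-stable)
open import Relation.Binary.PropositionalEquality
  using (_≡_; _≢_; refl; sym; trans; cong; subst; module ≡-Reasoning)
open import Function using (_∘_)
open import Function.Bundles using (_⇔_; Equivalence)
open import Relation.Binary.Construct.Closure.ReflexiveTransitive using (ε; _◅_)

private
  variable
    n : ℕ
    p q : Subset n
    x y : Fin n

x∈p-y⇒x≢y : x ∈ p - y → x ≢ y
x∈p-y⇒x≢y {x = zero}  {p = _ ∷ _} {zero}  ()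
x∈p-y⇒x≢y {x = suc x} {p = _ ∷ _} {zero}  _             ()
x∈p-y⇒x≢y {x = zero}  {p = _ ∷ _} {suc y} _             ()
x∈p-y⇒x≢y {x = suc x} {p = _ ∷ _} {suc y} (there x∈p-y) refl = x∈p-y⇒x≢y x∈p-y refl

x∈p⇒∣p∣≡1+∣p-x∣ : x ∈ p → ∣ p ∣ ≡ suc ∣ p - x ∣
x∈p⇒∣p∣≡1+∣p-x∣ {p = inside ∷ p} here = cong (suc ∘ ∣_∣) (sym (p─⊥≡p p))
x∈p⇒∣p∣≡1+∣p-x∣ {p = inside ∷ _} (there x∈p) = cong suc (x∈p⇒∣p∣≡1+∣p-x∣ x∈p)
x∈p⇒∣p∣≡1+∣p-x∣ {p = outside ∷ _} (there x∈p) = x∈p⇒∣p∣≡1+∣p-x∣ x∈p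

x∉p⇒p-x≡p : x ∉ p → p - x ≡ p
x∉p⇒p-x≡p {p = p} x∉p =
  ⊆-antisym (p─q⊆p p _) (λ y∈p → x∈p∧x≢y⇒x∈p-y y∈p λ { refl → x∉p y∈p })

∣p∣≤1+∣p-x∣ : ∀ (p : Subset n) x → ∣ p ∣ ≤ suc ∣ p - x ∣
∣p∣≤1+∣p-x∣ p x with x ∈? p
... | yes x∈p = ≤-reflexive (x∈p⇒∣p∣≡1+∣p-x∣ x∈p)
... | no  x∉p = subst (λ q → ∣ p ∣ ≤ suc ∣ q ∣) (sym (x∉p⇒p-x≡p x∉p)) (n≤1+n ∣ p ∣)

p-x≡q-y⇒∣p∣≡∣q∣ : p - x ≡ q - y → (x ∈ p → y ∈ q) → (y ∈ q → x ∈ p) → ∣ p ∣ ≡ ∣ q ∣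
p-x≡q-y⇒∣p∣≡∣q∣ {p = p} {x} {q} {y} p-x≡q-y x∈p⇒y∈q y∈q⇒x∈p with x ∈? p
... | yes x∈p = begin
  ∣ p ∣           ≡⟨ x∈p⇒∣p∣≡1+∣p-x∣ x∈p ⟩
  suc ∣ p - x ∣   ≡⟨ cong (suc ∘ ∣_∣) p-x≡q-y ⟩
  suc ∣ q - y ∣   ≡⟨ sym (x∈p⇒∣p∣≡1+∣p-x∣ (x∈p⇒y∈q x∈p)) ⟩
  ∣ q ∣           ∎
  where open ≡-Reasoning
... | no x∉p = begin
  ∣ p ∣           ≡⟨ cong ∣_∣ (sym (x∉p⇒p-x≡p x∉p)) ⟩
  ∣ p - x ∣       ≡⟨ cong ∣_∣ p-x≡q-y ⟩
  ∣ q - y ∣       ≡⟨ cong ∣_∣ (x∉p⇒p-x≡p (x∉p ∘ y∈q⇒x∈p)) ⟩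
  ∣ q ∣           ∎
  where open ≡-Reasoning

0<∣p∣⇒Nonempty : 0 < ∣ p ∣ → Nonempty p
0<∣p∣⇒Nonempty {p = inside ∷ _}  _ = zero , here
0<∣p∣⇒Nonempty {p = outside ∷ _} 0<∣p∣ =
  let z , z∈p = 0<∣p∣⇒Nonempty 0<∣p∣ in suc z , there z∈p

2<∣p∣⇒∃-∈-avoiding : 2 < ∣ p ∣ → ∀ x y → ∃ λ z → z ∈ p × z ≢ x × z ≢ y
2<∣p∣⇒∃-∈-avoiding {p = p} 2<∣p∣ x y =
  let z , z∈p-x-y = 0<∣p∣⇒Nonempty {p = p - x - y} 0<∣p-x-y∣
      z∈p-x       = p─q⊆p (p - x) _ z∈p-x-y
  in  z , p─q⊆p p _ z∈p-x , x∈p-y⇒x≢y z∈p-x , x∈p-y⇒x≢y z∈p-x-y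
  where
  0<∣p-x-y∣ : 0 < ∣ p - x - y ∣
  0<∣p-x-y∣ = s≤s⁻¹ (s≤s⁻¹ (≤-trans 2<∣p∣
    (≤-trans (∣p∣≤1+∣p-x∣ p x) (s≤s (∣p∣≤1+∣p-x∣ (p - x) y)))))

module Swap {A B : Subset n} {x y : Fin n}
            (leaves : ∀ z → (z ∈ A × z ∉ B) ⇔ (z ≡ x))
            (enters : ∀ z → (z ∈ B × z ∉ A) ⇔ (z ≡ y)) where

  x∈A : x ∈ A
  x∈A = proj₁ (Equivalence.from (leaves x) refl)

  y∉A : y ∉ A
  y∉A = proj₂ (Equivalence.from (enters y) refl)

  stays : ∀ {z} → z ∈ A → z ≢ x → z ∈ B
  stays {z} z∈A z≢x =
    decidable-stable (z ∈? B) λ z∉B → z≢x (Equivalence.to (leaves z) (z∈A , z∉B))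

  r∩A-x⊆r∩B-y : ∀ r → r ∩ A - x ⊆ r ∩ B - y
  r∩A-x⊆r∩B-y r z∈r∩A-x =
    let z∈r , z∈A = x∈p∩q⁻ r A (p─q⊆p (r ∩ A) _ z∈r∩A-x)
    in  x∈p∧x≢y⇒x∈p-y (x∈p∩q⁺ (z∈r , stays z∈A (x∈p-y⇒x≢y z∈r∩A-x))) λ { refl → y∉A z∈A }

pattern centre = zero
pattern leaf₁  = suc zero
pattern leaf₂  = suc (suc zero)
pattern middle = suc (suc (suc zero))
pattern end    = suc (suc (suc (suc zero)))

module _ {n : ℕ} (G : Graph n) where

  ∈-nbhd⁺ : ∀ {c v} → Edge G c v → v ∈ nbhd G c
  ∈-nbhd⁺ {c} {v} c~v =
    lookup⇒[]= v _ (trans (lookup∘tabulate _ v) (cong (if_then inside else outside) c~v))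

  ∈-nbhd⁻ : ∀ {c v} → v ∈ nbhd G c → Edge G c v
  ∈-nbhd⁻ {c} {v} v∈N =
    inside⇒true (adj G c v) (trans (sym (lookup∘tabulate _ v)) ([]=⇒lookup v∈N))
    where
    inside⇒true : ∀ b → (if b then inside else outside) ≡ inside → b ≡ true
    inside⇒true true _ = refl

  adj-sym : ∀ {u v b} → adj G u v ≡ b → adj G v u ≡ b
  adj-sym {u} {v} = trans (Graph.sym G v u)

  -- The two leaves are the only twins of the fork, so every other pair of
  -- vertices is separated by a third one.
  induced-fork : (v : Fin 5 → Fin n) → (∀ i j → adj G (v i) (v j) ≡ forkAdj i j) →
                 v leaf₁ ≢ v leaf₂ → InducedFork G
  induced-fork v preserves v₁≢v₂ = v , injective , preserves
    where
    open ≡-Reasoning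
    separated-by : ∀ {i j} k → forkAdj i k ≢ forkAdj j k → v i ≢ v j
    separated-by {i} {j} k differ vi≡vj = differ (begin
      forkAdj i k         ≡⟨ sym (preserves i k) ⟩
      adj G (v i) (v k)   ≡⟨ cong (λ u → adj G u (v k)) vi≡vj ⟩
      adj G (v j) (v k)   ≡⟨ preserves j k ⟩
      forkAdj j k         ∎)
    injective : ∀ i j → v i ≡ v j → i ≡ j
    injective centre centre _ = refl
    injective centre leaf₁  e = ⊥-elim (separated-by leaf₂ (λ ()) e)
    injective centre leaf₂  e = ⊥-elim (separated-by leaf₁ (λ ()) e)
    injective centre middle e = ⊥-elim (separated-by leaf₁ (λ ()) e)
    injective centre end    e = ⊥-elim (separated-by leaf₁ (λ ()) e)
    injective leaf₁  centre e = ⊥-elim (separated-by leaf₂ (λ ()) e)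
    injective leaf₁  leaf₁  _ = refl
    injective leaf₁  leaf₂  e = ⊥-elim (v₁≢v₂ e)
    injective leaf₁  middle e = ⊥-elim (separated-by end (λ ()) e)
    injective leaf₁  end    e = ⊥-elim (separated-by centre (λ ()) e)
    injective leaf₂  centre e = ⊥-elim (separated-by leaf₁ (λ ()) e)
    injective leaf₂  leaf₁  e = ⊥-elim (v₁≢v₂ (sym e))
    injective leaf₂  leaf₂  _ = refl
    injective leaf₂  middle e = ⊥-elim (separated-by end (λ ()) e)
    injective leaf₂  end    e = ⊥-elim (separated-by centre (λ ()) e)
    injective middle centre e = ⊥-elim (separated-by leaf₁ (λ ()) e)
    injective middle leaf₁  e = ⊥-elim (separated-by end (λ ()) e)
    injective middle leaf₂  e = ⊥-elim (separated-by end (λ ()) e)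
    injective middle middle _ = refl
    injective middle end    e = ⊥-elim (separated-by centre (λ ()) e)
    injective end    centre e = ⊥-elim (separated-by leaf₁ (λ ()) e)
    injective end    leaf₁  e = ⊥-elim (separated-by centre (λ ()) e)
    injective end    leaf₂  e = ⊥-elim (separated-by centre (λ ()) e)
    injective end    middle e = ⊥-elim (separated-by centre (λ ()) e)
    injective end    end    _ = refl

  module _ (fork-free : ForkFree G) where

    fork-free⇒triangle : ∀ {c a₁ a₂ x y} → a₁ ≢ a₂ →
      Edge G c a₁ → Edge G c a₂ → Edge G c x → Edge G x y →
      ¬ Edge G a₁ a₂ → ¬ Edge G a₁ x → ¬ Edge G a₂ x → ¬ Edge G a₁ y → ¬ Edge G a₂ y →
      Edge G c y
    fork-free⇒triangle {c} {a₁} {a₂} {x} {y} a₁≢a₂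
      c~a₁ c~a₂ c~x x~y a₁≁a₂ a₁≁x a₂≁x a₁≁y a₂≁y =
      decidable-stable (adj G c y ≟ᵇ true) λ c≁y →
        fork-free (induced-fork v (preserves (¬-not c≁y)) a₁≢a₂)
      where
      v : Fin 5 → Fin n
      v centre = c
      v leaf₁  = a₁
      v leaf₂  = a₂
      v middle = x
      v end    = y
      preserves : adj G c y ≡ false → ∀ i j → adj G (v i) (v j) ≡ forkAdj i j
      preserves _   centre centre = irrefl G c
      preserves _   centre leaf₁  = c~a₁
      preserves _   centre leaf₂  = c~a₂
      preserves _   centre middle = c~x
      preserves c≁y centre end    = c≁y
      preserves _   leaf₁  centre = adj-sym c~a₁
      preserves _   leaf₁  leaf₁  = irrefl G a₁
      preserves _   leaf₁  leaf₂  = ¬-not a₁≁a₂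
      preserves _   leaf₁  middle = ¬-not a₁≁x
      preserves _   leaf₁  end    = ¬-not a₁≁y
      preserves _   leaf₂  centre = adj-sym c~a₂
      preserves _   leaf₂  leaf₁  = adj-sym (¬-not a₁≁a₂)
      preserves _   leaf₂  leaf₂  = irrefl G a₂
      preserves _   leaf₂  middle = ¬-not a₂≁x
      preserves _   leaf₂  end    = ¬-not a₂≁y
      preserves _   middle centre = adj-sym c~x
      preserves _   middle leaf₁  = adj-sym (¬-not a₁≁x)
      preserves _   middle leaf₂  = adj-sym (¬-not a₂≁x)
      preserves _   middle middle = irrefl G x
      preserves _   middle end    = x~y
      preserves c≁y end    centre = adj-sym c≁y
      preserves _   end    leaf₁  = adj-sym (¬-not a₁≁y)
      preserves _   end    leaf₂  = adj-sym (¬-not a₂≁y)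
      preserves _   end    middle = adj-sym x~y
      preserves _   end    end    = irrefl G y

    slide-preserves-adjacency : ∀ {P Q c a₁ a₂ u w} → Independent G P → Independent G Q →
      a₁ ≢ a₂ → Edge G c a₁ → Edge G c a₂ → a₁ ∈ P × a₁ ∈ Q → a₂ ∈ P × a₂ ∈ Q →
      u ∈ P → w ∈ Q → Edge G u w → Edge G c u → Edge G c w
    slide-preserves-adjacency P-independent Q-independent a₁≢a₂ c~a₁ c~a₂
      (a₁∈P , a₁∈Q) (a₂∈P , a₂∈Q) u∈P w∈Q u~w c~u =
      fork-free⇒triangle a₁≢a₂ c~a₁ c~a₂ c~u u~w
        (P-independent _ _ a₁∈P a₂∈P) (P-independent _ _ a₁∈P u∈P) (P-independent _ _ a₂∈P u∈P)
        (Q-independent _ _ a₁∈Q w∈Q) (Q-independent _ _ a₂∈Q w∈Q)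

    TSStep-preserves-degIn : ∀ {A B} c → 2 < degIn G c A → TSStep G A B →
                             degIn G c A ≡ degIn G c B
    TSStep-preserves-degIn {A} {B} c 2<deg
      (A-independent , B-independent , x , y , leaves , enters , x~y)
      with a₁ , a₁∈N∩A , a₁≢x , _ ← 2<∣p∣⇒∃-∈-avoiding 2<deg x x
      with a₂ , a₂∈N∩A , a₂≢x , a₂≢a₁ ← 2<∣p∣⇒∃-∈-avoiding 2<deg x a₁ =
      p-x≡q-y⇒∣p∣≡∣q∣ (⊆-antisym (A→B.r∩A-x⊆r∩B-y N) (B→A.r∩A-x⊆r∩B-y N))
        (transfer y∈B (slide-preserves-adjacency A-independent B-independent a₁≢a₂ c~a₁ c~a₂
                        (a₁∈A , a₁∈B) (a₂∈A , a₂∈B) x∈A y∈B x~y))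
        (transfer x∈A (slide-preserves-adjacency B-independent A-independent a₁≢a₂ c~a₁ c~a₂
                        (a₁∈B , a₁∈A) (a₂∈B , a₂∈A) y∈B x∈A (adj-sym x~y)))
      where
      module A→B = Swap leaves enters
      module B→A = Swap enters leaves
      N = nbhd G c
      x∈A = A→B.x∈A
      y∈B = B→A.x∈A
      transfer : ∀ {P Q u w} → w ∈ Q → (Edge G c u → Edge G c w) → u ∈ N ∩ P → w ∈ N ∩ Q
      transfer {P} w∈Q c~u⇒c~w u∈N∩P =
        x∈p∩q⁺ (∈-nbhd⁺ (c~u⇒c~w (∈-nbhd⁻ (proj₁ (x∈p∩q⁻ N P u∈N∩P)))) , w∈Q)
      c~a₁ = ∈-nbhd⁻ (proj₁ (x∈p∩q⁻ N A a₁∈N∩A))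
      c~a₂ = ∈-nbhd⁻ (proj₁ (x∈p∩q⁻ N A a₂∈N∩A))
      a₁∈A = proj₂ (x∈p∩q⁻ N A a₁∈N∩A)
      a₂∈A = proj₂ (x∈p∩q⁻ N A a₂∈N∩A)
      a₁∈B = A→B.stays a₁∈A a₁≢x
      a₂∈B = A→B.stays a₂∈A a₂≢x
      a₁≢a₂ = a₂≢a₁ ∘ sym

    TSReach-preserves-degIn : ∀ {A B} c → 2 < degIn G c A → TSReach G A B →
                              degIn G c A ≡ degIn G c B
    TSReach-preserves-degIn c 2<deg ε = refl
    TSReach-preserves-degIn c 2<deg (step ◅ steps) =
      let deg-A≡deg-B = TSStep-preserves-degIn c 2<deg step
      in  trans deg-A≡deg-B (TSReach-preserves-degIn c (subst (2 <_) deg-A≡deg-B 2<deg) steps)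

lemma4p2 : ∀ {n} (G : Graph n) → ForkFree G →
    (I : Subset n) → Independent G I →
    (c : Fin n) (k : ℕ) → 3 ≤ k → degIn G c I ≡ k →
    (I' : Subset n) → Independent G I' → TSReach G I I' →
    degIn G c I' ≡ k
lemma4p2 G fork-free I _ c k 3≤k deg≡k I' _ reach =
  trans (sym (TSReach-preserves-degIn G fork-free c 2<deg reach)) deg≡k
  where
  2<deg : 2 < degIn G c I
  2<deg = subst (2 <_) (sym deg≡k) 3≤k
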